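{- Let $\Gamma$ be a simplicial complex having two distinct facets $\sigma_1,\sigma_2$ with $\dim\sigma_1,\dim\sigma_2\ge1$ such that, for $i=1,2$, each face of $\sigma_i$ of dimension $\dim\sigma_i-1$ is contained in no facet of $\Gamma$ other than $\sigma_i$. Then $\Gamma$ is not partitionable.
   Context: A simplicial complex is a family of subsets of a finite set closed under taking subsets; $\dim\sigma=|\sigma|-1$; facets are inclusion-maximal faces. $\Gamma$ is partitionable if $\Gamma$ can be written as a disjoint union $\Gamma=\dot\bigcup_{\sigma}[\tau_\sigma,\sigma]$ over all facets $\sigma$, where $\tau_\sigma\subseteq\sigma$ and $[\tau_\sigma,\sigma]=\{\eta\in\Gamma:\tau_\sigma\subseteq\eta\subseteq\sigma\}$. -}

module Defs where

open import Data.Nat using (ℕ; _≤_; _∸_)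
open import Data.Fin.Subset using (Subset; _⊆_; ∣_∣)
open import Data.Product using (Σ; _×_; ∃)
open import Relation.Binary.PropositionalEquality using (_≡_)
open import Relation.Nullary using (¬_)

Family : ℕ → Set₁
Family n = Subset n → Set

IsSimplicialComplex : ∀ {n} → Family n → Set
IsSimplicialComplex {n} Γ = ∀ (σ η : Subset n) → Γ σ → η ⊆ σ → Γ η

-- dim σ = |σ| - 1 ; we express dimension conditions via cardinality |σ|.

IsFacet : ∀ {n} → Family n → Subset n → Set
IsFacet {n} Γ σ = Γ σ × (∀ (ρ : Subset n) → Γ ρ → σ ⊆ ρ → ρ ≡ σ)

InInterval : ∀ {n} → Family n → Subset n → Subset n → Subset n → Set
InInterval Γ τ σ η = Γ η × τ ⊆ η × η ⊆ σ

IsPartitionable : ∀ {n} → Family n → Set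
IsPartitionable {n} Γ =
  Σ (Subset n → Subset n) λ τ →
    (∀ σ → IsFacet Γ σ → τ σ ⊆ σ)
    × (∀ η → Γ η → Σ (Subset n) λ σ → IsFacet Γ σ × InInterval Γ (τ σ) σ η)
    × (∀ η σ σ' → IsFacet Γ σ → IsFacet Γ σ' →
         InInterval Γ (τ σ) σ η → InInterval Γ (τ σ') σ' η → σ ≡ σ')

CodimOneFacesOnlyIn : ∀ {n} → Family n → Subset n → Set
CodimOneFacesOnlyIn {n} Γ σ =
  ∀ (η : Subset n) → η ⊆ σ → ∣ η ∣ ≡ ∣ σ ∣ ∸ 1 →
    ∀ (ρ : Subset n) → IsFacet Γ ρ → η ⊆ ρ → ρ ≡ σ

-- In a partition, the codimension-one face σ - v of such a facet σ lies in
-- σ's own interval, because σ is the only facet containing it.  Hence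
-- τ σ ⊆ σ - v for every vertex v of σ, i.e. τ σ = ∅.  The empty face then
-- lies in the intervals of both σ₁ and σ₂, contradicting disjointness.
module Submission where

open import Defs
open import Data.Nat using (ℕ; suc; _≤_; _∸_)
open import Data.Fin using (Fin)
open import Data.Fin.Subset
  using (Subset; ∣_∣; _⊆_; _∈_; _∉_; ⊥; _─_; _-_; inside; outside)
open import Data.Fin.Subset.Properties using (p─q⊆p; p─⊥≡p; x∈⁅x⁆; ⊥⊆)
open import Data.Vec using (_∷_; here; there)
open import Data.Product using (_,_; proj₁; proj₂)
open import Data.Empty using (⊥-elim)
open import Function using (_∘_)
open import Relation.Binary.PropositionalEquality using (_≡_; cong; subst)
open import Relation.Nullary using (¬_)

x∈q⇒x∉p─q : ∀ {n} {x : Fin n} (p q : Subset n) → x ∈ q → x ∉ p ─ q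
x∈q⇒x∉p─q (_ ∷ p) (inside  ∷ q) here        ()
x∈q⇒x∉p─q (_ ∷ p) (_       ∷ q) (there x∈q) (there x∈p─q) = x∈q⇒x∉p─q p q x∈q x∈p─q

x∉p-x : ∀ {n} (p : Subset n) (x : Fin n) → x ∉ p - x
x∉p-x p x = x∈q⇒x∉p─q p _ (x∈⁅x⁆ x)

x∈p⇒suc∣p-x∣≡∣p∣ : ∀ {n} {x : Fin n} (p : Subset n) → x ∈ p → suc ∣ p - x ∣ ≡ ∣ p ∣
x∈p⇒suc∣p-x∣≡∣p∣ (inside  ∷ p) here        = cong (suc ∘ ∣_∣) (p─⊥≡p p)
x∈p⇒suc∣p-x∣≡∣p∣ (inside  ∷ p) (there x∈p) = cong suc (x∈p⇒suc∣p-x∣≡∣p∣ p x∈p)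
x∈p⇒suc∣p-x∣≡∣p∣ (outside ∷ p) (there x∈p) = x∈p⇒suc∣p-x∣≡∣p∣ p x∈p

x∈p⇒∣p-x∣≡∣p∣∸1 : ∀ {n} {x : Fin n} (p : Subset n) → x ∈ p → ∣ p - x ∣ ≡ ∣ p ∣ ∸ 1
x∈p⇒∣p-x∣≡∣p∣∸1 p x∈p = cong (_∸ 1) (x∈p⇒suc∣p-x∣≡∣p∣ p x∈p)

module _ {n} {Γ : Family n} (closed : IsSimplicialComplex Γ) (partition : IsPartitionable Γ) where

  private
    τ : Subset n → Subset n
    τ = proj₁ partition

  τ-facet-⊆ : ∀ {σ} → IsFacet Γ σ → τ σ ⊆ σ
  τ-facet-⊆ = proj₁ (proj₂ partition) _

  τ⊆codim-one-face : ∀ {σ} {v : Fin n} → IsFacet Γ σ → CodimOneFacesOnlyIn Γ σ →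
                     v ∈ σ → τ σ ⊆ σ - v
  τ⊆codim-one-face {σ} {v} σ-facet only-σ v∈σ
    with proj₁ (proj₂ (proj₂ partition)) (σ - v) (closed σ (σ - v) (proj₁ σ-facet) (p─q⊆p σ _))
  ... | ρ , ρ-facet , _ , τρ⊆σ-v , σ-v⊆ρ =
    subst (λ ρ → τ ρ ⊆ σ - v) ρ≡σ τρ⊆σ-v
    where
    ρ≡σ : ρ ≡ σ
    ρ≡σ = only-σ (σ - v) (p─q⊆p σ _) (x∈p⇒∣p-x∣≡∣p∣∸1 σ v∈σ) ρ ρ-facet σ-v⊆ρ

  τ-empty : ∀ {σ} → IsFacet Γ σ → CodimOneFacesOnlyIn Γ σ → τ σ ⊆ ⊥
  τ-empty {σ} σ-facet only-σ {v} v∈τσ =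
    ⊥-elim (x∉p-x σ v (τ⊆codim-one-face σ-facet only-σ (τ-facet-⊆ σ-facet v∈τσ) v∈τσ))

  ∅-in-interval : ∀ {σ} → IsFacet Γ σ → CodimOneFacesOnlyIn Γ σ → InInterval Γ (τ σ) σ ⊥
  ∅-in-interval {σ} σ-facet only-σ = closed σ ⊥ (proj₁ σ-facet) ⊥⊆ , τ-empty σ-facet only-σ , ⊥⊆

  facets-with-private-codim-one-faces-coincide :
    ∀ {σ₁ σ₂} → IsFacet Γ σ₁ → IsFacet Γ σ₂ →
    CodimOneFacesOnlyIn Γ σ₁ → CodimOneFacesOnlyIn Γ σ₂ → σ₁ ≡ σ₂
  facets-with-private-codim-one-faces-coincide f₁ f₂ only₁ only₂ =
    proj₂ (proj₂ (proj₂ partition)) ⊥ _ _ f₁ f₂ (∅-in-interval f₁ only₁) (∅-in-interval f₂ only₂)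

proposition3p7 : ∀ (n : ℕ) (Γ : Family n) → IsSimplicialComplex Γ →
    ∀ (σ₁ σ₂ : Subset n) → IsFacet Γ σ₁ → IsFacet Γ σ₂ → ¬ (σ₁ ≡ σ₂) →
    2 ≤ ∣ σ₁ ∣ → 2 ≤ ∣ σ₂ ∣ →
    CodimOneFacesOnlyIn Γ σ₁ → CodimOneFacesOnlyIn Γ σ₂ →
    ¬ IsPartitionable Γ
proposition3p7 n Γ closed σ₁ σ₂ f₁ f₂ σ₁≢σ₂ _ _ only₁ only₂ partition =
  σ₁≢σ₂ (facets-with-private-codim-one-faces-coincide closed partition f₁ f₂ only₁ only₂)
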